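{- Let $q$ be a prime power, let $n\ge1$, and let $m_1,\dots,m_n\ge1$, $s_1,\dots,s_n\ge1$ and $u_1,\dots,u_n\ge0$ be integers, and let $\mathbf{e}_k=(e^{(k)}_1,\dots,e^{(k)}_{s_k})\in\mathbb{N}^{s_k}$ for $1\le k\le n$. If digital $(u_k,m_k,\mathbf{e}_k,s_k)$-nets over $\mathbb{F}_q$ are given for $1\le k\le n$, then there exists a digital $\left(u,\sum_{k=1}^nm_k,\mathbf{e},\sum_{k=1}^ns_k\right)$-net over $\mathbb{F}_q$ with $u=\sum_{k=1}^nm_k-\min_{1\le k\le n}(m_k-u_k)$ and $\mathbf{e}=(e^{(1)}_1,\dots,e^{(1)}_{s_1},e^{(2)}_1,\dots,e^{(2)}_{s_2},\dots,e^{(n)}_1,\dots,e^{(n)}_{s_n})\in\mathbb{N}^{s_1+\cdots+s_n}$.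
   Context: $\mathbb{N}$ denotes the positive integers, $\lambda_s$ Lebesgue measure. An elementary interval in base $b$ is $J=\prod_{i=1}^s[a_ib^{ -d_i},(a_i+1)b^{ -d_i})$ with integers $d_i\ge0$, $0\le a_i<b^{d_i}$. For integers $0\le u\le m$ and $\mathbf{e}=(e_1,\dots,e_s)\in\mathbb{N}^s$, a set of $b^m$ points in $[0,1)^s$ is a $(u,m,\mathbf{e},s)$-net in base $b$ if every elementary interval $J$ in base $b$ with $\lambda_s(J)\ge b^{u-m}$ and $e_i\mid d_i$ for all $i$ contains exactly $b^m\lambda_s(J)$ of the points. Digital net over $\mathbb{F}_q$: given $m\times m$ generating matrices $C_1,\dots,C_s$ over $\mathbb{F}_q$, bijections $\eta_r:Z_q\to\mathbb{F}_q$ ($0\le r<m$) and $\kappa_{i,j}:\mathbb{F}_q\to Z_q$ where $Z_q=\{0,\dots,q-1\}$, for $0\le n<q^m$ with base-$q$ digits $n_0,\dots,n_{m-1}$ put $(y^{(i)}_{n,1},\dots,y^{(i)}_{n,m})^\top=C_i(\eta_0(n_0),\dots,\eta_{m-1}(n_{m-1}))^\top$, $x_n^{(i)}=\sum_{j=1}^m\kappa_{i,j}(y^{(i)}_{n,j})q^{ -j}$, $\mathbf{x}_n=(x_n^{(1)},\dots,x_n^{(s)})$. The resulting point set is a digital net over $\mathbb{F}_q$; it is a digital $(u,m,\mathbf{e},s)$-net over $\mathbb{F}_q$ if it is a $(u,m,\mathbf{e},s)$-net in base $q$. -}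

module Defs where

open import Level using (0ℓ)
open import Data.Nat using (ℕ; zero; suc; _+_; _*_; _∸_; _^_; _≤_; _<_; _⊓_)
open import Data.Nat.Divisibility using (_∣_)
open import Data.Nat.Primality using (Prime)
open import Data.Fin using (Fin; zero; suc; splitAt)
open import Data.Fin.Properties using (all?)
open import Data.Sum using (inj₁; inj₂)
open import Data.Product using (Σ; ∃; _×_; _,_)
open import Data.List using (List; length; filter; upTo)
open import Relation.Nullary using (¬_; Dec)
open import Relation.Binary.PropositionalEquality using (_≡_)
open import Function.Bundles using (_⤖_; Bijection)
open import Algebra.Structures using (IsCommutativeRing)
import Data.Nat.Properties as ℕP
open import Relation.Nullary.Decidable using (_×-dec_)

IsPrimePower : ℕ → Set
IsPrimePower q = Σ ℕ λ p → Σ ℕ λ k → Prime p × 1 ≤ k × q ≡ p ^ k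

record Field : Set₁ where
  field
    Carrier : Set
    _⊕_ _⊗_ : Carrier → Carrier → Carrier
    ⊖_      : Carrier → Carrier
    0# 1#   : Carrier
    isCommutativeRing : IsCommutativeRing _≡_ _⊕_ _⊗_ ⊖_ 0# 1#
    0≢1     : ¬ (0# ≡ 1#)
    inverse : ∀ x → ¬ (x ≡ 0#) → Σ Carrier λ y → x ⊗ y ≡ 1#

record FiniteField (q : ℕ) : Set₁ where
  field
    field′ : Field
  open Field field′ public
  field
    enum : Fin q ⤖ Carrier

sumF : ∀ {n} → (Fin n → ℕ) → ℕ
sumF {zero}  f = 0
sumF {suc n} f = f zero + sumF (λ k → f (suc k))

minF : ∀ {n} → (Fin (suc n) → ℕ) → ℕ
minF {zero}  f = f zero
minF {suc n} f = f zero ⊓ minF (λ k → f (suc k))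

concatF : ∀ {A : Set} {n} (s : Fin n → ℕ) → (∀ k → Fin (s k) → A) → Fin (sumF s) → A
concatF {n = zero}  s e ()
concatF {n = suc n} s e i with splitAt (s zero) i
... | inj₁ j = e zero j
... | inj₂ j = concatF (λ k → s (suc k)) (λ k → e (suc k)) j

countBelow : (N : ℕ) (P : ℕ → Set) → (∀ n → Dec (P n)) → ℕ
countBelow N P P? = length (filter P? (upTo N))

record DigitalNetData {q : ℕ} (F : FiniteField q) (m s : ℕ) : Set where
  open FiniteField F
  field
    C : Fin s → Fin m → Fin m → Carrier      -- C i j r = (C_i)_{j,r}
    η : Fin m → (Fin q ⤖ Carrier)
    κ : Fin s → Fin m → (Carrier ⤖ Fin q)

module _ {q : ℕ} {F : FiniteField q} where
  open FiniteField F

  sumField : ∀ {m} → (Fin m → Carrier) → Carrier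
  sumField {zero}  f = 0#
  sumField {suc m} f = f zero ⊕ sumField (λ r → f (suc r))

  sumDigits : ∀ {m} → (Fin m → ℕ) → ℕ
  sumDigits {zero}  c = 0
  sumDigits {suc m} c = c zero * q ^ m + sumDigits (λ j → c (suc j))

  -- r-th base-q digit of n (r = 0 least significant)
  digit : .{{_ : Data.Nat.NonZero q}} → ℕ → ℕ → Fin q
  digit n zero    = Data.Fin.fromℕ< (m%n<n n q)
    where open import Data.Nat.DivMod
  digit n (suc r) = digit (n / q) r
    where open import Data.Nat.DivMod

  -- Numerator X with x_n^{(i)} = X / q^m, for the i-th coordinate of the n-th point
  pointNum : .{{_ : Data.Nat.NonZero q}} → ∀ {m s} → DigitalNetData F m s → ℕ → Fin s → ℕ
  pointNum {m} {s} D n i =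
    sumDigits {m} λ j → Data.Fin.toℕ (Bijection.to (κ i j)
      (sumField {m} λ r → C i j r ⊗ Bijection.to (η r) (digit n (Data.Fin.toℕ r))))
    where open DigitalNetData D

-- The point x_n (numerators over q^m) lies in the elementary interval
-- Π_i [a_i q^{-d_i}, (a_i+1) q^{-d_i})  (for d_i ≤ m)
InBox : ∀ {s} (q m : ℕ) (d a : Fin s → ℕ) (X : Fin s → ℕ) → Set
InBox q m d a X = ∀ i → (a i * q ^ (m ∸ d i) ≤ X i) × (X i < suc (a i) * q ^ (m ∸ d i))

inBox? : ∀ {s} (q m : ℕ) (d a X : Fin s → ℕ) → Dec (InBox q m d a X)
inBox? q m d a X = all? λ i → (_ ℕP.≤? _) ×-dec (_ ℕP.<? _)

-- Elementary intervals with λ(J) = q^{-Σ d_i} ≥ q^{u-m},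
-- i.e. Σ d_i ≤ m - u, and e_i ∣ d_i must contain exactly q^{m - Σ d_i} points.
IsNet : ∀ {s} (q u m : ℕ) (e : Fin s → ℕ) (P : ℕ → Fin s → ℕ) → Set
IsNet {s} q u m e P =
  u ≤ m ×
  ((d a : Fin s → ℕ) → sumF d ≤ m ∸ u → (∀ i → e i ∣ d i) → (∀ i → a i < q ^ d i) →
    countBelow (q ^ m) (λ n → InBox q m d a (P n)) (λ n → inBox? q m d a (P n))
      ≡ q ^ (m ∸ sumF d))

IsDigitalNet : ∀ {q} (F : FiniteField q) .{{_ : Data.Nat.NonZero q}} (u m : ℕ) {s : ℕ}
  (e : Fin s → ℕ) → DigitalNetData F m s → Set
IsDigitalNet {q} F u m e D = IsNet q u m e (pointNum D)

ExistsDigitalNet : ∀ {q} (F : FiniteField q) .{{_ : Data.Nat.NonZero q}} (u m s : ℕ)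
  (e : Fin s → ℕ) → Set
ExistsDigitalNet F u m s e = Σ (DigitalNetData F m s) λ D → IsDigitalNet F u m e D

module Submission where

-- Given digital nets D₁ (m₁ digits, s₁ coordinates) and D₂ (m₂ digits, s₂
-- coordinates), their direct sum has block-diagonal generating matrices: the
-- first s₁ coordinates apply D₁'s matrices to the m₁ low input digits of n and
-- write the result into their m₁ leading output digits, the last s₂ coordinates
-- do the same with D₂ and the m₂ high input digits.  Hence the n-th point of the
-- direct sum is, up to trailing digits, the pair of the (n mod q^m₁)-th point of
-- D₁ and the (n div q^m₁)-th point of D₂, and an elementary box of the direct
-- sum contains exactly the product of the numbers of points of D₁ and D₂ in the
-- two factor boxes.  So if both nets count every admissible box with |d| ≤ t
-- exactly ("uniform of strength t"), so does the direct sum.  Iterating over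
-- k = 1..n, with the empty net as unit, at the strength t = min_k (m_k - u_k)
-- proves the corollary.

open import Defs
open import Data.Nat using (ℕ; zero; suc; _+_; _*_; _∸_; _^_; _≤_; _<_; z≤n; s≤s; s≤s⁻¹; z<s; s<s; NonZero)
open import Data.Nat.Properties
open import Data.Nat.DivMod
open import Data.Nat.Divisibility using (_∣_; m∣m*n)
open import Data.Bool using (Bool; true; false; _∧_; if_then_else_)
open import Data.Fin using (Fin; zero; suc; toℕ; _↑ˡ_; _↑ʳ_; splitAt; join; cast)
open import Data.Fin.Properties using (toℕ<n; toℕ-↑ˡ; toℕ-↑ʳ; splitAt-↑ˡ; splitAt-↑ʳ; join-splitAt; cast-is-id; fromℕ<-cong)
open import Data.List using (length; filter; applyUpTo)
open import Data.Sum using (_⊎_; inj₁; inj₂; [_,_]′; map₁)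
open import Data.Product using (_×_; _,_; proj₁; proj₂)
open import Data.Product.Function.NonDependent.Propositional using (_×-⇔_)
open import Function using (_∘_; id)
open import Function.Bundles using (_⇔_; mk⇔; Equivalence; _⤖_; Bijection)
open import Function.Properties.Bijection using (sym-≡)
open import Relation.Nullary using (Dec; does)
open import Relation.Nullary.Decidable using (does-⇔; _×-dec_)
open import Relation.Binary.PropositionalEquality
open import Algebra.Structures using (IsCommutativeRing)
open import Data.Nat.Tactic.RingSolver using (solve-∀)

bit : Bool → ℕ
bit b = if b then 1 else 0

count : ℕ → (ℕ → Bool) → ℕ
count zero    f = 0
count (suc N) f = bit (f 0) + count N (f ∘ suc)

-- `countBelow` (from Defs) is `count` applied to the decision procedure;
-- stated for a shifted range so that the induction goes through.
length-filter≡count : ∀ {P : ℕ → Set} (P? : ∀ n → Dec (P n)) N (f : ℕ → ℕ) →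
  length (filter P? (applyUpTo f N)) ≡ count N (does ∘ P? ∘ f)
length-filter≡count P? zero    f = refl
length-filter≡count P? (suc N) f with does (P? (f 0))
... | true  = cong suc (length-filter≡count P? N (f ∘ suc))
... | false = length-filter≡count P? N (f ∘ suc)

countBelow≡count : ∀ N {P : ℕ → Set} (P? : ∀ n → Dec (P n)) → countBelow N P P? ≡ count N (does ∘ P?)
countBelow≡count N P? = length-filter≡count P? N id

count-cong : ∀ N {f g : ℕ → Bool} → (∀ n → n < N → f n ≡ g n) → count N f ≡ count N g
count-cong zero    eq = refl
count-cong (suc N) eq = cong₂ _+_ (cong bit (eq 0 z<s)) (count-cong N (λ n n<N → eq (suc n) (s<s n<N)))

count-+ : ∀ x y f → count (x + y) f ≡ count x f + count y (λ n → f (x + n))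
count-+ zero    y f = refl
count-+ (suc x) y f = trans (cong (bit (f 0) +_) (count-+ x y (f ∘ suc))) (sym (+-assoc (bit (f 0)) _ _))

bit-∧ : ∀ a b → bit (a ∧ b) ≡ bit a * bit b
bit-∧ true  true  = refl
bit-∧ true  false = refl
bit-∧ false b     = refl

count-∧-const : ∀ N f b → count N (λ n → f n ∧ b) ≡ count N f * bit b
count-∧-const zero    f b = refl
count-∧-const (suc N) f b = trans (cong₂ _+_ (bit-∧ (f 0) b) (count-∧-const N (f ∘ suc) b))
                                  (sym (*-distribʳ-+ (bit b) (bit (f 0)) _))

count-product : ∀ A .{{_ : NonZero A}} B (f g : ℕ → Bool) →
  count (A * B) (λ n → f (n % A) ∧ g (n / A)) ≡ count A f * count B g
count-product A zero f g =
  trans (cong (λ k → count k (λ n → f (n % A) ∧ g (n / A))) (*-zeroʳ A)) (sym (*-zeroʳ (count A f)))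
count-product A (suc B) f g = begin
  count (A * suc B) h                                     ≡⟨ cong (λ k → count k h) (*-suc A B) ⟩
  count (A + A * B) h                                     ≡⟨ count-+ A (A * B) h ⟩
  count A h + count (A * B) (λ n → h (A + n))             ≡⟨ cong₂ _+_ (count-cong A first-block) (count-cong (A * B) later-blocks) ⟩
  count A (λ n → f n ∧ g 0) + count (A * B) (λ n → f (n % A) ∧ g (suc (n / A)))
                                                          ≡⟨ cong₂ _+_ (count-∧-const A f (g 0)) (count-product A B f (g ∘ suc)) ⟩
  count A f * bit (g 0) + count A f * count B (g ∘ suc)   ≡⟨ sym (*-distribˡ-+ (count A f) _ _) ⟩
  count A f * count (suc B) g                             ∎
  where
  open ≡-Reasoning
  h : ℕ → Bool
  h n = f (n % A) ∧ g (n / A)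
  first-block : ∀ n → n < A → h n ≡ (f n ∧ g 0)
  first-block n n<A = cong₂ (λ x y → f x ∧ g y) (m<n⇒m%n≡m n<A) (m<n⇒m/n≡0 n<A)
  later-blocks : ∀ n → n < A * B → h (A + n) ≡ (f (n % A) ∧ g (suc (n / A)))
  later-blocks n _ = cong₂ (λ x y → f x ∧ g y)
    (trans (cong (_% A) (+-comm A n)) ([m+n]%n≡m%n n A))
    (trans (m/n≡1+[m∸n]/n (m≤m+n A n)) (cong (λ k → suc (k / A)) (m+n∸m≡n A n)))

-- Cells of the grid of width c: x lies in the a-th cell [a·c, (a+1)·c).
-- `InBox q m d a X` is by definition `∀ i → InCell (q ^ (m ∸ d i)) (a i) (X i)`.
InCell : (c a x : ℕ) → Set
InCell c a x = a * c ≤ x × x < suc a * c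

offset-<-next : ∀ {B R} → R < B → ∀ x → x * B + R < suc x * B
offset-<-next {B} {R} R<B x = begin-strict
  x * B + R  <⟨ +-monoʳ-< (x * B) R<B ⟩
  x * B + B  ≡⟨ +-comm (x * B) B ⟩
  suc x * B  ∎
  where open ≤-Reasoning

multiple-≤-offset : ∀ {B R} → R < B → ∀ x y → y * B ≤ x * B + R ⇔ y ≤ x
multiple-≤-offset {B} {R} R<B x y = mk⇔
  (λ yB≤xB+R → s≤s⁻¹ (*-cancelʳ-< B y (suc x) (≤-<-trans yB≤xB+R (offset-<-next R<B x))))
  (λ y≤x → ≤-trans (*-monoˡ-≤ B y≤x) (m≤m+n (x * B) R))

offset-<-multiple : ∀ {B R} → R < B → ∀ x y → x * B + R < y * B ⇔ x < y
offset-<-multiple {B} {R} R<B x y = mk⇔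
  (λ xB+R<yB → *-cancelʳ-< B x y (≤-<-trans (m≤m+n (x * B) R) xB+R<yB))
  (λ x<y → <-≤-trans (offset-<-next R<B x) (*-monoˡ-≤ B x<y))

inCell-refine : ∀ {B R} → R < B → ∀ c a x → InCell (c * B) a (x * B + R) ⇔ InCell c a x
inCell-refine {B} {R} R<B c a x =
  subst₂ (λ lower upper → (lower ≤ x * B + R × x * B + R < upper) ⇔ InCell c a x)
         (*-assoc a c B) (*-assoc (suc a) c B)
         (multiple-≤-offset R<B x (a * c) ×-⇔ offset-<-multiple R<B x (suc a * c))

record Extension (q k x X : ℕ) : Set where
  constructor extension
  field
    tail      : ℕ
    tail<q^k  : tail < q ^ k
    expansion : X ≡ x * q ^ k + tail

inCell-extend : ∀ {q k m x X} M {d} a → M ≡ m + k → d ≤ m → Extension q k x X →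
  InCell (q ^ (M ∸ d)) a X ⇔ InCell (q ^ (m ∸ d)) a x
inCell-extend {q} {k} {m} {x} .(m + k) {d} a refl d≤m (extension R R<q^k refl) =
  subst (λ c → InCell c a (x * q ^ k + R) ⇔ InCell (q ^ (m ∸ d)) a x) (sym width)
        (inCell-refine R<q^k (q ^ (m ∸ d)) a x)
  where
  width : q ^ (m + k ∸ d) ≡ q ^ (m ∸ d) * q ^ k
  width = trans (cong (q ^_) (+-∸-comm k d≤m)) (^-distribˡ-+-* q (m ∸ d) k)

∀-splitAt : ∀ s₁ {s₂} {P : Fin (s₁ + s₂) → Set} →
  (∀ i → P (i ↑ˡ s₂)) → (∀ j → P (s₁ ↑ʳ j)) → ∀ i → P i
∀-splitAt s₁ {s₂} {P} left right i = subst P (join-splitAt s₁ s₂ i) (by-block (splitAt s₁ i))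
  where
  by-block : ∀ v → P (join s₁ s₂ v)
  by-block (inj₁ i₁) = left i₁
  by-block (inj₂ i₂) = right i₂

inBox-split : ∀ {q m₁ m₂ s₁ s₂} (d a X : Fin (s₁ + s₂) → ℕ) (x₁ : Fin s₁ → ℕ) (x₂ : Fin s₂ → ℕ) →
  (∀ i → d (i ↑ˡ s₂) ≤ m₁) → (∀ j → d (s₁ ↑ʳ j) ≤ m₂) →
  (∀ i → Extension q m₂ (x₁ i) (X (i ↑ˡ s₂))) → (∀ j → Extension q m₁ (x₂ j) (X (s₁ ↑ʳ j))) →
  InBox q (m₁ + m₂) d a X ⇔
    (InBox q m₁ (d ∘ (_↑ˡ s₂)) (a ∘ (_↑ˡ s₂)) x₁ × InBox q m₂ (d ∘ (s₁ ↑ʳ_)) (a ∘ (s₁ ↑ʳ_)) x₂)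
inBox-split {q} {m₁} {m₂} {s₁} {s₂} d a X x₁ x₂ d₁≤m₁ d₂≤m₂ ext₁ ext₂ = mk⇔
  (λ box → (λ i → Equivalence.to (cell₁ i) (box (i ↑ˡ s₂))) , (λ j → Equivalence.to (cell₂ j) (box (s₁ ↑ʳ j))))
  (λ (box₁ , box₂) → ∀-splitAt s₁ {P = λ i → InCell (q ^ (m₁ + m₂ ∸ d i)) (a i) (X i)}
                       (λ i → Equivalence.from (cell₁ i) (box₁ i)) (λ j → Equivalence.from (cell₂ j) (box₂ j)))
  where
  cell₁ : ∀ i → InCell (q ^ (m₁ + m₂ ∸ d (i ↑ˡ s₂))) (a (i ↑ˡ s₂)) (X (i ↑ˡ s₂))
              ⇔ InCell (q ^ (m₁ ∸ d (i ↑ˡ s₂))) (a (i ↑ˡ s₂)) (x₁ i)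
  cell₁ i = inCell-extend (m₁ + m₂) (a (i ↑ˡ s₂)) refl (d₁≤m₁ i) (ext₁ i)
  cell₂ : ∀ j → InCell (q ^ (m₁ + m₂ ∸ d (s₁ ↑ʳ j))) (a (s₁ ↑ʳ j)) (X (s₁ ↑ʳ j))
              ⇔ InCell (q ^ (m₂ ∸ d (s₁ ↑ʳ j))) (a (s₁ ↑ʳ j)) (x₂ j)
  cell₂ j = inCell-extend (m₁ + m₂) (a (s₁ ↑ʳ j)) (+-comm m₁ m₂) (d₂≤m₂ j) (ext₂ j)

sumF-splitAt : ∀ s₁ {s₂} (d : Fin (s₁ + s₂) → ℕ) → sumF d ≡ sumF (d ∘ (_↑ˡ s₂)) + sumF (d ∘ (s₁ ↑ʳ_))
sumF-splitAt zero     d = refl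
sumF-splitAt (suc s₁) d = trans (cong (d zero +_) (sumF-splitAt s₁ (d ∘ suc))) (sym (+-assoc (d zero) _ _))

≤-sumF : ∀ {s} (d : Fin s → ℕ) i → d i ≤ sumF d
≤-sumF d zero    = m≤m+n (d zero) _
≤-sumF d (suc i) = ≤-trans (≤-sumF (d ∘ suc) i) (m≤n+m _ (d zero))

minF-≤ : ∀ {n} (f : Fin (suc n) → ℕ) k → minF f ≤ f k
minF-≤ {zero}  f zero    = ≤-refl
minF-≤ {suc n} f zero    = m⊓n≤m (f zero) _
minF-≤ {suc n} f (suc k) = ≤-trans (m⊓n≤n (f zero) _) (minF-≤ (f ∘ suc) k)

concatF-splitAt : ∀ {A : Set} {n} (s : Fin (suc n) → ℕ) (e : ∀ k → Fin (s k) → A) i →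
  [ e zero , concatF (s ∘ suc) (e ∘ suc) ]′ (splitAt (s zero) i) ≡ concatF s e i
concatF-splitAt s e i with splitAt (s zero) i
... | inj₁ _ = refl
... | inj₂ _ = refl

∸-distrib-+ : ∀ {m₁ m₂ S₁ S₂} → S₁ ≤ m₁ → S₂ ≤ m₂ → m₁ + m₂ ∸ (S₁ + S₂) ≡ (m₁ ∸ S₁) + (m₂ ∸ S₂)
∸-distrib-+ {m₁} {m₂} {S₁} {S₂} S₁≤m₁ S₂≤m₂ = begin
  m₁ + m₂ ∸ (S₁ + S₂)    ≡⟨ sym (∸-+-assoc (m₁ + m₂) S₁ S₂) ⟩
  m₁ + m₂ ∸ S₁ ∸ S₂      ≡⟨ cong (_∸ S₂) (+-∸-comm m₂ S₁≤m₁) ⟩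
  (m₁ ∸ S₁) + m₂ ∸ S₂    ≡⟨ +-∸-assoc (m₁ ∸ S₁) S₂≤m₂ ⟩
  (m₁ ∸ S₁) + (m₂ ∸ S₂)  ∎
  where open ≡-Reasoning

-- A (u,m,e,s)-net is exactly a point
-- set uniform of strength m - u.
record Uniform (q t m : ℕ) {s : ℕ} (e : Fin s → ℕ) (P : ℕ → Fin s → ℕ) : Set where
  field
    fits  : (d : Fin s → ℕ) → sumF d ≤ t → sumF d ≤ m
    exact : (d a : Fin s → ℕ) → sumF d ≤ t → (∀ i → e i ∣ d i) → (∀ i → a i < q ^ d i) →
            countBelow (q ^ m) (λ n → InBox q m d a (P n)) (λ n → inBox? q m d a (P n)) ≡ q ^ (m ∸ sumF d)

net⇒uniform : ∀ {q u m t s} {e : Fin s → ℕ} {P} → IsNet q u m e P → t ≤ m ∸ u → Uniform q t m e P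
net⇒uniform {u = u} {m} (_ , exact) t≤m∸u = record
  { fits  = λ d |d|≤t → ≤-trans |d|≤t (≤-trans t≤m∸u (m∸n≤m m u))
  ; exact = λ d a |d|≤t → exact d a (≤-trans |d|≤t t≤m∸u)
  }

uniform⇒net : ∀ {q t m s} {e : Fin s → ℕ} {P} → Uniform q t m e P → t ≤ m → IsNet q (m ∸ t) m e P
uniform⇒net {t = t} {m} U t≤m =
  m∸n≤m m t , λ d a |d|≤ → Uniform.exact U d a (subst (sumF d ≤_) (m∸[m∸n]≡n t≤m) |d|≤)

uniform-respects : ∀ {q t m s} {e e′ : Fin s → ℕ} {P} → (∀ i → e i ≡ e′ i) → Uniform q t m e P → Uniform q t m e′ P
uniform-respects e≡e′ U = record
  { fits  = Uniform.fits U
  ; exact = λ d a |d|≤t e′∣d → Uniform.exact U d a |d|≤t (λ i → subst (_∣ d i) (sym (e≡e′ i)) (e′∣d i))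
  }

module DigitalNets (q : ℕ) .{{_ : NonZero q}} (F : FiniteField q) where
  open FiniteField F
  open IsCommutativeRing isCommutativeRing
    using () renaming (+-assoc to ⊕-assoc; +-identityˡ to ⊕-identityˡ; +-identityʳ to ⊕-identityʳ; zeroˡ to ⊗-zeroˡ)
  open DigitalNetData

  q^-nonZero : ∀ k → NonZero (q ^ k)
  q^-nonZero k = m^n≢0 q k

  private
    value : ∀ {m} → (Fin m → ℕ) → ℕ
    value = sumDigits {F = F}

    fsum : ∀ {m} → (Fin m → Carrier) → Carrier
    fsum = sumField {F = F}

    digitOf : ℕ → ℕ → Fin q
    digitOf = digit {F = F}

  value-cong : ∀ {m} {c c′ : Fin m → ℕ} → (∀ j → c j ≡ c′ j) → value c ≡ value c′
  value-cong {zero}  eq = refl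
  value-cong {suc m} eq = cong₂ _+_ (cong (_* q ^ m) (eq zero)) (value-cong (eq ∘ suc))

  value-cast : ∀ {m m′} (eq : m ≡ m′) (c : Fin m′ → ℕ) → value (c ∘ cast eq) ≡ value c
  value-cast refl c = value-cong (λ j → cong c (cast-is-id refl j))

  value-< : ∀ {m} (c : Fin m → ℕ) → (∀ j → c j < q) → value c < q ^ m
  value-< {zero}  c c<q = s≤s z≤n
  value-< {suc m} c c<q = begin-strict
    c zero * q ^ m + value (c ∘ suc)  <⟨ +-monoʳ-< (c zero * q ^ m) (value-< (c ∘ suc) (c<q ∘ suc)) ⟩
    c zero * q ^ m + q ^ m            ≡⟨ +-comm (c zero * q ^ m) (q ^ m) ⟩
    suc (c zero) * q ^ m              ≤⟨ *-monoˡ-≤ (q ^ m) (c<q zero) ⟩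
    q * q ^ m                         ∎
    where open ≤-Reasoning

  value-splitAt : ∀ m₁ {m₂} (c : Fin m₁ ⊎ Fin m₂ → ℕ) →
    value (c ∘ splitAt m₁) ≡ value (c ∘ inj₁) * q ^ m₂ + value (c ∘ inj₂)
  value-splitAt zero    c = refl
  value-splitAt (suc m₁) {m₂} c = begin
    c (inj₁ zero) * q ^ (m₁ + m₂) + value (c ∘ map₁ suc ∘ splitAt m₁)
      ≡⟨ cong₂ (λ p rest → c (inj₁ zero) * p + rest) (^-distribˡ-+-* q m₁ m₂) (value-splitAt m₁ (c ∘ map₁ suc)) ⟩
    c (inj₁ zero) * (q ^ m₁ * q ^ m₂) + (value (c ∘ inj₁ ∘ suc) * q ^ m₂ + value (c ∘ inj₂))
      ≡⟨ shift (c (inj₁ zero)) (q ^ m₁) (q ^ m₂) (value (c ∘ inj₁ ∘ suc)) (value (c ∘ inj₂)) ⟩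
    (c (inj₁ zero) * q ^ m₁ + value (c ∘ inj₁ ∘ suc)) * q ^ m₂ + value (c ∘ inj₂)
      ∎
    where
    open ≡-Reasoning
    shift : ∀ c a b x y → c * (a * b) + (x * b + y) ≡ (c * a + x) * b + y
    shift = solve-∀

  extension-splitAt : ∀ m₁ {m₂} (c : Fin m₁ ⊎ Fin m₂ → ℕ) → (∀ w → c w < q) →
    Extension q m₂ (value (c ∘ inj₁)) (value (c ∘ splitAt m₁))
  extension-splitAt m₁ c c<q = extension _ (value-< (c ∘ inj₂) (c<q ∘ inj₂)) (value-splitAt m₁ c)

  fsum-cong : ∀ {m} {f g : Fin m → Carrier} → (∀ r → f r ≡ g r) → fsum f ≡ fsum g
  fsum-cong {zero}  eq = refl
  fsum-cong {suc m} eq = cong₂ _⊕_ (eq zero) (fsum-cong (eq ∘ suc))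

  fsum-splitAt : ∀ m₁ {m₂} (f : Fin m₁ ⊎ Fin m₂ → Carrier) →
    fsum (f ∘ splitAt m₁) ≡ fsum (f ∘ inj₁) ⊕ fsum (f ∘ inj₂)
  fsum-splitAt zero     f = sym (⊕-identityˡ _)
  fsum-splitAt (suc m₁) f = trans (cong (f (inj₁ zero) ⊕_) (fsum-splitAt m₁ (f ∘ map₁ suc)))
                                  (sym (⊕-assoc _ _ _))

  fsum-zeros : ∀ {m} → fsum {m} (λ _ → 0#) ≡ 0#
  fsum-zeros {zero}  = refl
  fsum-zeros {suc m} = trans (cong (0# ⊕_) (fsum-zeros {m})) (⊕-identityˡ 0#)

  dot : ∀ {m} → (Fin m → Carrier) → (Fin m → Carrier) → Carrier
  dot a x = fsum (λ r → a r ⊗ x r)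

  dot-zerosˡ : ∀ {m} (x : Fin m → Carrier) → dot (λ _ → 0#) x ≡ 0#
  dot-zerosˡ {m} x = trans (fsum-cong (λ r → ⊗-zeroˡ (x r))) (fsum-zeros {m})

  dot-splitAt : ∀ m₁ {m₂} (a x : Fin m₁ ⊎ Fin m₂ → Carrier) →
    dot (a ∘ splitAt m₁) (x ∘ splitAt m₁) ≡ dot (a ∘ inj₁) (x ∘ inj₁) ⊕ dot (a ∘ inj₂) (x ∘ inj₂)
  dot-splitAt m₁ a x = fsum-splitAt m₁ (λ w → a w ⊗ x w)

  digit-low : ∀ k r n → r < k → digitOf n r ≡ digitOf ((n % q ^ k) {{q^-nonZero k}}) r
  digit-low (suc k) zero n _ =
    fromℕ<-cong _ _ (sym (m∣n⇒o%n%m≡o%m q (q ^ suc k) n (m∣m*n (q ^ k)))) _ _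
    where instance _ : NonZero (q ^ suc k)
                   _ = q^-nonZero (suc k)
  digit-low (suc k) (suc r) n (s≤s r<k) = begin
    digitOf (n / q) r                ≡⟨ digit-low k r (n / q) r<k ⟩
    digitOf (n / q % q ^ k) r        ≡⟨ cong (λ y → digitOf y r) quotient-of-remainder ⟩
    digitOf (n % q ^ suc k / q) r    ∎
    where
    open ≡-Reasoning
    instance
      _ : NonZero (q ^ k)
      _ = q^-nonZero k
      _ : NonZero (q ^ suc k)
      _ = q^-nonZero (suc k)
      _ : NonZero (q ^ k * q)
      _ = m*n≢0 (q ^ k) q
    quotient-of-remainder : n / q % q ^ k ≡ n % q ^ suc k / q
    quotient-of-remainder = sym (trans (/-congˡ (%-congʳ (*-comm q (q ^ k)))) (m%[n*o]/o≡m/o%n n (q ^ k) q))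

  digit-high : ∀ k r n → digitOf n (k + r) ≡ digitOf ((n / q ^ k) {{q^-nonZero k}}) r
  digit-high zero    r n = cong (λ y → digitOf y r) (sym (n/1≡n n))
  digit-high (suc k) r n =
    trans (digit-high k r (n / q)) (cong (λ y → digitOf y r) (m/n/o≡m/[n*o] n q (q ^ k)))
    where instance _ : NonZero (q ^ k)
                   _ = q^-nonZero k
                   _ : NonZero (q ^ suc k)
                   _ = q^-nonZero (suc k)

  digit-splitAt : ∀ m₁ {m₂} n (r : Fin (m₁ + m₂)) →
    digitOf n (toℕ r) ≡ [ (λ r₁ → digitOf ((n % q ^ m₁) {{q^-nonZero m₁}}) (toℕ r₁))
                        , (λ r₂ → digitOf ((n / q ^ m₁) {{q^-nonZero m₁}}) (toℕ r₂)) ]′ (splitAt m₁ r)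
  digit-splitAt m₁ {m₂} n = ∀-splitAt m₁ {P = λ r → digitOf n (toℕ r) ≡ blocks (splitAt m₁ r)} low high
    where
    instance _ : NonZero (q ^ m₁)
             _ = q^-nonZero m₁
    blocks : Fin m₁ ⊎ Fin m₂ → Fin q
    blocks = [ (λ r₁ → digitOf (n % q ^ m₁) (toℕ r₁)) , (λ r₂ → digitOf (n / q ^ m₁) (toℕ r₂)) ]′
    low : ∀ r₁ → digitOf n (toℕ (r₁ ↑ˡ m₂)) ≡ blocks (splitAt m₁ (r₁ ↑ˡ m₂))
    low r₁ = trans (cong (digitOf n) (toℕ-↑ˡ r₁ m₂))
                   (trans (digit-low m₁ (toℕ r₁) n (toℕ<n r₁)) (cong blocks (sym (splitAt-↑ˡ m₁ r₁ m₂))))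
    high : ∀ r₂ → digitOf n (toℕ (m₁ ↑ʳ r₂)) ≡ blocks (splitAt m₁ (m₁ ↑ʳ r₂))
    high r₂ = trans (cong (digitOf n) (toℕ-↑ʳ m₁ r₂))
                    (trans (digit-high m₁ (toℕ r₂) n) (cong blocks (sym (splitAt-↑ʳ m₁ m₂ r₂))))

  inputs : ∀ {m s} → DigitalNetData F m s → ℕ → Fin m → Carrier
  inputs D n r = Bijection.to (η D r) (digitOf n (toℕ r))

  module DirectSum {m₁ s₁ m₂ s₂} (D₁ : DigitalNetData F m₁ s₁) (D₂ : DigitalNetData F m₂ s₂) where

    -- point n of the direct sum combines point n mod A of D₁ with point n div A of D₂
    A : ℕ
    A = q ^ m₁

    instance
      A-nonZero : NonZero A
      A-nonZero = q^-nonZero m₁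

    zeros : ∀ {k} → Fin k → Carrier
    zeros _ = 0#

    -- the output digits of the padding rows are read through an arbitrary bijection
    padding : Carrier ⤖ Fin q
    padding = sym-≡ enum

    -- the second block's rows are the m₂ leading rows
    rows₂ : Fin (m₁ + m₂) → Fin m₂ ⊎ Fin m₁
    rows₂ j = splitAt m₂ (cast (+-comm m₁ m₂) j)

    -- generating matrices, by block of the coordinate: D₁'s in the leading rows
    -- and first m₁ columns, D₂'s in the leading rows and last m₂ columns
    matrix : Fin s₁ ⊎ Fin s₂ → Fin (m₁ + m₂) → Fin (m₁ + m₂) → Carrier
    matrix (inj₁ i) j r = [ (λ j₁ → [ C D₁ i j₁ , zeros ]′ (splitAt m₁ r)) , zeros ]′ (splitAt m₁ j)
    matrix (inj₂ i) j r = [ (λ j₂ → [ zeros , C D₂ i j₂ ]′ (splitAt m₁ r)) , zeros ]′ (rows₂ j)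

    outputs : Fin s₁ ⊎ Fin s₂ → Fin (m₁ + m₂) → Carrier ⤖ Fin q
    outputs (inj₁ i) j = [ κ D₁ i , (λ _ → padding) ]′ (splitAt m₁ j)
    outputs (inj₂ i) j = [ κ D₂ i , (λ _ → padding) ]′ (rows₂ j)

    directSum : DigitalNetData F (m₁ + m₂) (s₁ + s₂)
    directSum = record
      { C = matrix ∘ splitAt s₁
      ; η = λ r → [ η D₁ , η D₂ ]′ (splitAt m₁ r)
      ; κ = outputs ∘ splitAt s₁
      }

    inputs-splitAt : ∀ n r →
      inputs directSum n r ≡ [ inputs D₁ (n % A) , inputs D₂ (n / A) ]′ (splitAt m₁ r)
    inputs-splitAt n r = trans (cong (Bijection.to ([ η D₁ , η D₂ ]′ (splitAt m₁ r))) (digit-splitAt m₁ n r))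
                               (per-block (splitAt m₁ r))
      where
      per-block : ∀ w → Bijection.to ([ η D₁ , η D₂ ]′ w)
                          ([ (λ r₁ → digitOf (n % A) (toℕ r₁)) , (λ r₂ → digitOf (n / A) (toℕ r₂)) ]′ w)
                        ≡ [ inputs D₁ (n % A) , inputs D₂ (n / A) ]′ w
      per-block (inj₁ r₁) = refl
      per-block (inj₂ r₂) = refl

    row₁ : ∀ n (a : Fin m₁ → Carrier) →
      dot (λ r → [ a , zeros ]′ (splitAt m₁ r)) (inputs directSum n) ≡ dot a (inputs D₁ (n % A))
    row₁ n a = begin
      dot (λ r → [ a , zeros ]′ (splitAt m₁ r)) (inputs directSum n)
        ≡⟨ fsum-cong (λ r → cong ([ a , zeros ]′ (splitAt m₁ r) ⊗_) (inputs-splitAt n r)) ⟩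
      dot ([ a , zeros ]′ ∘ splitAt m₁) ([ inputs D₁ (n % A) , inputs D₂ (n / A) ]′ ∘ splitAt m₁)
        ≡⟨ dot-splitAt m₁ [ a , zeros ]′ [ inputs D₁ (n % A) , inputs D₂ (n / A) ]′ ⟩
      dot a (inputs D₁ (n % A)) ⊕ dot zeros (inputs D₂ (n / A))
        ≡⟨ cong (dot a (inputs D₁ (n % A)) ⊕_) (dot-zerosˡ (inputs D₂ (n / A))) ⟩
      dot a (inputs D₁ (n % A)) ⊕ 0#
        ≡⟨ ⊕-identityʳ _ ⟩
      dot a (inputs D₁ (n % A)) ∎
      where open ≡-Reasoning

    row₂ : ∀ n (b : Fin m₂ → Carrier) →
      dot (λ r → [ zeros , b ]′ (splitAt m₁ r)) (inputs directSum n) ≡ dot b (inputs D₂ (n / A))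
    row₂ n b = begin
      dot (λ r → [ zeros , b ]′ (splitAt m₁ r)) (inputs directSum n)
        ≡⟨ fsum-cong (λ r → cong ([ zeros , b ]′ (splitAt m₁ r) ⊗_) (inputs-splitAt n r)) ⟩
      dot ([ zeros , b ]′ ∘ splitAt m₁) ([ inputs D₁ (n % A) , inputs D₂ (n / A) ]′ ∘ splitAt m₁)
        ≡⟨ dot-splitAt m₁ [ zeros , b ]′ [ inputs D₁ (n % A) , inputs D₂ (n / A) ]′ ⟩
      dot zeros (inputs D₁ (n % A)) ⊕ dot b (inputs D₂ (n / A))
        ≡⟨ cong (_⊕ dot b (inputs D₂ (n / A))) (dot-zerosˡ (inputs D₁ (n % A))) ⟩
      0# ⊕ dot b (inputs D₂ (n / A))
        ≡⟨ ⊕-identityˡ _ ⟩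
      dot b (inputs D₂ (n / A)) ∎
      where open ≡-Reasoning

    -- The numerator of a coordinate of the direct sum, by block of the coordinate;
    -- `pointNum directSum n i` is `coordinate (splitAt s₁ i) n` by definition.
    coordinate : Fin s₁ ⊎ Fin s₂ → ℕ → ℕ
    coordinate v n = value (λ j → toℕ (Bijection.to (outputs v j) (dot (matrix v j) (inputs directSum n))))

    coordinate₁ : ∀ n i → Extension q m₂ (pointNum D₁ (n % A) i) (pointNum directSum n (i ↑ˡ s₂))
    coordinate₁ n i = subst₂ (Extension q m₂) leading (cong (λ v → coordinate v n) (sym (splitAt-↑ˡ s₁ i s₂)))
                             (extension-splitAt m₁ digits (λ _ → toℕ<n _))
      where
      digits : Fin m₁ ⊎ Fin m₂ → ℕ
      digits w = toℕ (Bijection.to ([ κ D₁ i , (λ _ → padding) ]′ w)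
                       (dot (λ r → [ (λ j₁ → [ C D₁ i j₁ , zeros ]′ (splitAt m₁ r)) , zeros ]′ w) (inputs directSum n)))
      leading : value (digits ∘ inj₁) ≡ pointNum D₁ (n % A) i
      leading = value-cong (λ j₁ → cong (toℕ ∘ Bijection.to (κ D₁ i j₁)) (row₁ n (C D₁ i j₁)))

    coordinate₂ : ∀ n i → Extension q m₁ (pointNum D₂ (n / A) i) (pointNum directSum n (s₁ ↑ʳ i))
    coordinate₂ n i = subst₂ (Extension q m₁) leading reindex (extension-splitAt m₂ digits (λ _ → toℕ<n _))
      where
      digits : Fin m₂ ⊎ Fin m₁ → ℕ
      digits w = toℕ (Bijection.to ([ κ D₂ i , (λ _ → padding) ]′ w)
                       (dot (λ r → [ (λ j₂ → [ zeros , C D₂ i j₂ ]′ (splitAt m₁ r)) , zeros ]′ w) (inputs directSum n)))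
      leading : value (digits ∘ inj₁) ≡ pointNum D₂ (n / A) i
      leading = value-cong (λ j₂ → cong (toℕ ∘ Bijection.to (κ D₂ i j₂)) (row₂ n (C D₂ i j₂)))
      reindex : value (digits ∘ splitAt m₂) ≡ pointNum directSum n (s₁ ↑ʳ i)
      reindex = trans (sym (value-cast (+-comm m₁ m₂) (digits ∘ splitAt m₂)))
                      (cong (λ v → coordinate v n) (sym (splitAt-↑ʳ s₁ s₂ i)))

    -- The direct sum of two point sets uniform of strength t is uniform of
    -- strength t: a box of the direct sum is a product of boxes of the factors,
    -- and its points are counted through n ↦ (n mod q^m₁, n div q^m₁).
    directSum-uniform : ∀ {t} {e₁ : Fin s₁ → ℕ} {e₂ : Fin s₂ → ℕ} →
      Uniform q t m₁ e₁ (pointNum D₁) → Uniform q t m₂ e₂ (pointNum D₂) →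
      Uniform q t (m₁ + m₂) ([ e₁ , e₂ ]′ ∘ splitAt s₁) (pointNum directSum)
    directSum-uniform {t} {e₁} {e₂} U₁ U₂ = record { fits = fits ; exact = exact }
      where
      module U₁ = Uniform U₁
      module U₂ = Uniform U₂

      blocks-≤ : (d : Fin (s₁ + s₂) → ℕ) → sumF d ≤ t →
        sumF (d ∘ (_↑ˡ s₂)) ≤ t × sumF (d ∘ (s₁ ↑ʳ_)) ≤ t
      blocks-≤ d |d|≤t = ≤-trans (m≤m+n _ _) |d|≤t′ , ≤-trans (m≤n+m _ _) |d|≤t′
        where
        |d|≤t′ : sumF (d ∘ (_↑ˡ s₂)) + sumF (d ∘ (s₁ ↑ʳ_)) ≤ t
        |d|≤t′ = subst (_≤ t) (sumF-splitAt s₁ d) |d|≤t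

      fits : (d : Fin (s₁ + s₂) → ℕ) → sumF d ≤ t → sumF d ≤ m₁ + m₂
      fits d |d|≤t = subst (_≤ m₁ + m₂) (sym (sumF-splitAt s₁ d))
        (+-mono-≤ (U₁.fits _ (proj₁ (blocks-≤ d |d|≤t))) (U₂.fits _ (proj₂ (blocks-≤ d |d|≤t))))

      exact : (d a : Fin (s₁ + s₂) → ℕ) → sumF d ≤ t → (∀ i → [ e₁ , e₂ ]′ (splitAt s₁ i) ∣ d i) →
        (∀ i → a i < q ^ d i) →
        countBelow (q ^ (m₁ + m₂)) (λ n → InBox q (m₁ + m₂) d a (pointNum directSum n))
                                   (λ n → inBox? q (m₁ + m₂) d a (pointNum directSum n))
          ≡ q ^ (m₁ + m₂ ∸ sumF d)
      exact d a |d|≤t e∣d a<q^d = begin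
        countBelow (q ^ (m₁ + m₂)) _ (λ n → inBox? q (m₁ + m₂) d a (pointNum directSum n))
          ≡⟨ countBelow≡count (q ^ (m₁ + m₂)) (λ n → inBox? q (m₁ + m₂) d a (pointNum directSum n)) ⟩
        count (q ^ (m₁ + m₂)) (λ n → does (inBox? q (m₁ + m₂) d a (pointNum directSum n)))
          ≡⟨ count-cong (q ^ (m₁ + m₂)) (λ n _ → does-⇔ (product-box n) (inBox? q (m₁ + m₂) d a (pointNum directSum n))
                                                           (inBox? q m₁ d₁ a₁ (pointNum D₁ (n % A)) ×-dec inBox? q m₂ d₂ a₂ (pointNum D₂ (n / A)))) ⟩
        count (q ^ (m₁ + m₂)) (λ n → in₁ (n % A) ∧ in₂ (n / A))
          ≡⟨ cong (λ N → count N (λ n → in₁ (n % A) ∧ in₂ (n / A))) (^-distribˡ-+-* q m₁ m₂) ⟩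
        count (A * q ^ m₂) (λ n → in₁ (n % A) ∧ in₂ (n / A))
          ≡⟨ count-product A (q ^ m₂) in₁ in₂ ⟩
        count A in₁ * count (q ^ m₂) in₂
          ≡⟨ cong₂ _*_ (trans (sym (countBelow≡count A _)) (U₁.exact d₁ a₁ |d₁|≤t e₁∣d₁ (a<q^d ∘ (_↑ˡ s₂))))
                       (trans (sym (countBelow≡count (q ^ m₂) _)) (U₂.exact d₂ a₂ |d₂|≤t e₂∣d₂ (a<q^d ∘ (s₁ ↑ʳ_)))) ⟩
        q ^ (m₁ ∸ sumF d₁) * q ^ (m₂ ∸ sumF d₂)
          ≡⟨ sym (^-distribˡ-+-* q (m₁ ∸ sumF d₁) (m₂ ∸ sumF d₂)) ⟩
        q ^ ((m₁ ∸ sumF d₁) + (m₂ ∸ sumF d₂))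
          ≡⟨ cong (q ^_) (sym (trans (cong (m₁ + m₂ ∸_) (sumF-splitAt s₁ d)) (∸-distrib-+ |d₁|≤m₁ |d₂|≤m₂))) ⟩
        q ^ (m₁ + m₂ ∸ sumF d) ∎
        where
        open ≡-Reasoning
        d₁ a₁ : Fin s₁ → ℕ
        d₁ = d ∘ (_↑ˡ s₂)
        a₁ = a ∘ (_↑ˡ s₂)
        d₂ a₂ : Fin s₂ → ℕ
        d₂ = d ∘ (s₁ ↑ʳ_)
        a₂ = a ∘ (s₁ ↑ʳ_)
        |d₁|≤t : sumF d₁ ≤ t
        |d₁|≤t = proj₁ (blocks-≤ d |d|≤t)
        |d₂|≤t : sumF d₂ ≤ t
        |d₂|≤t = proj₂ (blocks-≤ d |d|≤t)
        |d₁|≤m₁ : sumF d₁ ≤ m₁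
        |d₁|≤m₁ = U₁.fits d₁ |d₁|≤t
        |d₂|≤m₂ : sumF d₂ ≤ m₂
        |d₂|≤m₂ = U₂.fits d₂ |d₂|≤t
        e₁∣d₁ : ∀ i → e₁ i ∣ d₁ i
        e₁∣d₁ i = subst (_∣ d₁ i) (cong [ e₁ , e₂ ]′ (splitAt-↑ˡ s₁ i s₂)) (e∣d (i ↑ˡ s₂))
        e₂∣d₂ : ∀ j → e₂ j ∣ d₂ j
        e₂∣d₂ j = subst (_∣ d₂ j) (cong [ e₁ , e₂ ]′ (splitAt-↑ʳ s₁ s₂ j)) (e∣d (s₁ ↑ʳ j))
        in₁ : ℕ → Bool
        in₁ n = does (inBox? q m₁ d₁ a₁ (pointNum D₁ n))
        in₂ : ℕ → Bool
        in₂ n = does (inBox? q m₂ d₂ a₂ (pointNum D₂ n))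
        product-box : ∀ n → InBox q (m₁ + m₂) d a (pointNum directSum n) ⇔
          (InBox q m₁ d₁ a₁ (pointNum D₁ (n % A)) × InBox q m₂ d₂ a₂ (pointNum D₂ (n / A)))
        product-box n = inBox-split d a (pointNum directSum n) (pointNum D₁ (n % A)) (pointNum D₂ (n / A))
          (λ i → ≤-trans (≤-sumF d₁ i) |d₁|≤m₁) (λ j → ≤-trans (≤-sumF d₂ j) |d₂|≤m₂)
          (coordinate₁ n) (coordinate₂ n)

  emptyNet : DigitalNetData F 0 0
  emptyNet = record { C = λ () ; η = λ () ; κ = λ () }

  -- It is trivially uniform of every strength: its single point lies in the only box.
  emptyNet-uniform : ∀ t (e : Fin 0 → ℕ) → Uniform q t 0 e (pointNum emptyNet)
  emptyNet-uniform t e = record { fits = λ _ _ → z≤n ; exact = λ _ _ _ _ _ → refl }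

  directSums : ∀ {n} (m s : Fin n → ℕ) → (∀ k → DigitalNetData F (m k) (s k)) → DigitalNetData F (sumF m) (sumF s)
  directSums {zero}  m s D = emptyNet
  directSums {suc n} m s D = DirectSum.directSum (D zero) (directSums (m ∘ suc) (s ∘ suc) (D ∘ suc))

  directSums-uniform : ∀ {n t} (m s : Fin n → ℕ) (e : ∀ k → Fin (s k) → ℕ) (D : ∀ k → DigitalNetData F (m k) (s k)) →
    (∀ k → Uniform q t (m k) (e k) (pointNum (D k))) →
    Uniform q t (sumF m) (concatF s e) (pointNum (directSums m s D))
  directSums-uniform {zero}  m s e D U = emptyNet-uniform _ _
  directSums-uniform {suc n} m s e D U = uniform-respects (concatF-splitAt s e)
    (DirectSum.directSum-uniform (D zero) _ (U zero) (directSums-uniform (m ∘ suc) (s ∘ suc) (e ∘ suc) (D ∘ suc) (U ∘ suc)))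

corollary1 : (q : ℕ) → IsPrimePower q → .{{_ : NonZero q}} → (F : FiniteField q) →
    (n : ℕ) (m s u : Fin (suc n) → ℕ) (e : (k : Fin (suc n)) → Fin (s k) → ℕ) →
    (∀ k → 1 ≤ m k) → (∀ k → 1 ≤ s k) → (∀ k i → 1 ≤ e k i) →
    (∀ k → ExistsDigitalNet F (u k) (m k) (s k) (e k)) →
    ExistsDigitalNet F (sumF m ∸ minF (λ k → m k ∸ u k)) (sumF m) (sumF s) (concatF s e)
-- The corollary: the direct sum of the given nets, uniform of the least strength.
corollary1 q _ F n m s u e _ _ _ nets = directSums m s D , uniform⇒net uniform t≤sumF-m
  where
  open DigitalNets q F
  strengths : Fin (suc n) → ℕ
  strengths k = m k ∸ u k
  t : ℕ
  t = minF strengths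
  D : ∀ k → DigitalNetData F (m k) (s k)
  D k = proj₁ (nets k)
  uniform : Uniform q t (sumF m) (concatF s e) (pointNum (directSums m s D))
  uniform = directSums-uniform m s e D (λ k → net⇒uniform (proj₂ (nets k)) (minF-≤ strengths k))
  t≤sumF-m : t ≤ sumF m
  t≤sumF-m = ≤-trans (minF-≤ strengths zero) (≤-trans (m∸n≤m (m zero) (u zero)) (≤-sumF m zero))
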